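{- For positive integers $k<n$, the clique number of the $k$-derangement graph satisfies $\omega(\Gamma_{k,n})\le\binom{n}{k}$.
   Context: $S_n$ is the symmetric group on $[n]=\{1,\dots,n\}$. For $\sigma\in S_n$, $\sigma_{(k)}$ denotes the induced permutation of the set of $k$-element subsets of $[n]$, $\sigma_{(k)}(\{a_1,\dots,a_k\})=\{\sigma(a_1),\dots,\sigma(a_k)\}$; $\sigma$ is a $k$-derangement if $\sigma_{(k)}$ fixes no $k$-element subset. Let $\mathcal{D}_{k,n}$ be the set of $k$-derangements in $S_n$. The $k$-derangement graph $\Gamma_{k,n}$ is the Cayley graph $\Gamma(S_n,\mathcal{D}_{k,n})$: vertices are the elements of $S_n$, and $u,v$ are adjacent iff $su=v$ for some $s\in\mathcal{D}_{k,n}$. $\omega(G)$ denotes the maximum size of a clique in $G$. -}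

module Defs where

open import Data.Nat using (ℕ)
open import Data.Fin using (Fin)
open import Data.Fin.Subset using (Subset; _∈_; ∣_∣)
open import Data.Fin.Permutation using (Permutation′; _⟨$⟩ʳ_)
open import Data.Product using (Σ; ∃; _×_; _,_)
open import Data.List using (List)
open import Data.List.Relation.Unary.AllPairs using (AllPairs)
open import Relation.Binary.PropositionalEquality using (_≡_)
open import Relation.Nullary using (¬_)
open import Function.Bundles using (_⇔_)

IsKSubset : {n : ℕ} → ℕ → Subset n → Set
IsKSubset k S = ∣ S ∣ ≡ k

_∈Image_ : {n : ℕ} → Fin n → Permutation′ n × Subset n → Set
y ∈Image (σ , S) = ∃ λ a → a ∈ S × (σ ⟨$⟩ʳ a ≡ y)

Fixes : {n : ℕ} → Permutation′ n → Subset n → Set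
Fixes σ S = ∀ y → (y ∈Image (σ , S)) ⇔ (y ∈ S)

IsKDerangement : {n : ℕ} → ℕ → Permutation′ n → Set
IsKDerangement k σ = ∀ S → IsKSubset k S → ¬ Fixes σ S

_≈ₚ_ : {n : ℕ} → Permutation′ n → Permutation′ n → Set
u ≈ₚ v = ∀ x → u ⟨$⟩ʳ x ≡ v ⟨$⟩ʳ x

Adjacent : {n : ℕ} → ℕ → Permutation′ n → Permutation′ n → Set
Adjacent k u v = Σ _ λ s → IsKDerangement k s × (∀ x → s ⟨$⟩ʳ (u ⟨$⟩ʳ x) ≡ v ⟨$⟩ʳ x)

IsClique : {n : ℕ} → ℕ → List (Permutation′ n) → Set
IsClique k C = AllPairs (λ u v → ¬ (u ≈ₚ v) × Adjacent k u v) C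

module Submission where

-- Fix any k-element subset A of [n] and send each vertex u of a clique to the
-- k-subset u(A).  If u and v are adjacent, then v = s ∘ u for a k-derangement s,
-- so v(A) = s(u(A)); were u(A) = v(A), the permutation s would fix the k-subset
-- u(A), which is impossible.  Hence the members of a clique have pairwise
-- distinct images of A, and a clique has at most as many members as there are
-- k-subsets of [n], namely C(n,k).

open import Defs
open import Data.Nat using (ℕ; zero; suc; pred; _+_; _<_; _≤_; z≤n; s≤s)
open import Data.Nat.Properties
  using (≤-refl; +-mono-≤; <⇒≤; +-suc; +-0-commutativeMonoid; module ≤-Reasoning)
open import Data.Nat.Combinatorics using (_C_; nCk+nC[k+1]≡[n+1]C[k+1])
open import Data.Bool using (Bool; true; false)
open import Data.Fin using (Fin)
open import Data.Fin.Subset using (Subset; _∈_; ∣_∣; ⊥)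
open import Data.Fin.Subset.Properties using (∣⊥∣≡0)
open import Data.Fin.Permutation
  using (Permutation′; _⟨$⟩ʳ_; _⟨$⟩ˡ_; inverseˡ; inverseʳ; flip)
open import Data.Vec using ([]; _∷_; lookup; tabulate)
open import Data.Vec.Properties using ([]=⇒lookup; lookup⇒[]=; lookup∘tabulate; tabulate-cong)
open import Data.List using (List; []; _∷_; length; map)
open import Data.List.Properties using (length-map)
open import Data.List.Relation.Unary.All using (All; []; _∷_; universal)
import Data.List.Relation.Unary.All.Properties as All
open import Data.List.Relation.Unary.AllPairs using ([]; _∷_)
import Data.List.Relation.Unary.AllPairs as AllPairs
import Data.List.Relation.Unary.AllPairs.Properties as AllPairs
open import Data.List.Relation.Unary.Unique.Propositional using (Unique)
open import Data.Empty using (⊥-elim) renaming (⊥ to Empty)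
open import Data.Product using (Σ; _,_)
open import Function using (_∘_; id)
open import Function.Bundles using (_⇔_; mk⇔; Equivalence)
open import Relation.Binary.PropositionalEquality
  using (_≡_; _≢_; refl; sym; trans; cong; subst; module ≡-Reasoning)
open import Algebra.Properties.CommutativeMonoid.Sum +-0-commutativeMonoid
  using (sum; sum-cong-≗; sum-permute)

HaveSize : {n : ℕ} → ℕ → List (Subset n) → Set
HaveSize k = All (λ S → ∣ S ∣ ≡ k)

module _ {n : ℕ} where

  -- Subsets of [n+1] containing (resp. avoiding) the first point, with that
  -- point removed: the two halves of the bijection behind Pascal's rule.
  containing avoiding : List (Subset (suc n)) → List (Subset n)
  containing []                = []
  containing ((true  ∷ S) ∷ L) = S ∷ containing L
  containing ((false ∷ S) ∷ L) = containing L

  avoiding []                = []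
  avoiding ((true  ∷ S) ∷ L) = avoiding L
  avoiding ((false ∷ S) ∷ L) = S ∷ avoiding L

  length-split : (L : List (Subset (suc n))) →
                 length L ≡ length (containing L) + length (avoiding L)
  length-split []                = refl
  length-split ((true  ∷ S) ∷ L) = cong suc (length-split L)
  length-split ((false ∷ S) ∷ L) = trans (cong suc (length-split L)) (sym (+-suc _ _))

  containing-All : {P : Subset (suc n) → Set} {Q : Subset n → Set} →
                   (∀ {S} → P (true ∷ S) → Q S) →
                   ∀ {L} → All P L → All Q (containing L)
  containing-All f {[]}              []       = []
  containing-All f {(true  ∷ S) ∷ L} (p ∷ ps) = f p ∷ containing-All f ps
  containing-All f {(false ∷ S) ∷ L} (p ∷ ps) = containing-All f ps

  avoiding-All : {P : Subset (suc n) → Set} {Q : Subset n → Set} →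
                 (∀ {S} → P (false ∷ S) → Q S) →
                 ∀ {L} → All P L → All Q (avoiding L)
  avoiding-All f {[]}              []       = []
  avoiding-All f {(true  ∷ S) ∷ L} (p ∷ ps) = avoiding-All f ps
  avoiding-All f {(false ∷ S) ∷ L} (p ∷ ps) = f p ∷ avoiding-All f ps

  containing-Unique : ∀ {L} → Unique L → Unique (containing L)
  containing-Unique {[]}              []       = []
  containing-Unique {(true  ∷ S) ∷ L} (p ∷ ps) =
    containing-All (λ S≢T S≡T → S≢T (cong (true ∷_) S≡T)) p ∷ containing-Unique ps
  containing-Unique {(false ∷ S) ∷ L} (p ∷ ps) = containing-Unique ps

  avoiding-Unique : ∀ {L} → Unique L → Unique (avoiding L)
  avoiding-Unique {[]}              []       = []
  avoiding-Unique {(true  ∷ S) ∷ L} (p ∷ ps) = avoiding-Unique ps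
  avoiding-Unique {(false ∷ S) ∷ L} (p ∷ ps) =
    avoiding-All (λ S≢T S≡T → S≢T (cong (false ∷_) S≡T)) p ∷ avoiding-Unique ps

  -- An empty subset never contains the first point.
  containing-empty : ∀ {L} → HaveSize 0 L → length (containing L) ≡ 0
  containing-empty sizes = length-of-empty (containing-All (λ ()) sizes)
    where
    length-of-empty : ∀ {M : List (Subset n)} → All (λ _ → Empty) M → length M ≡ 0
    length-of-empty []       = refl
    length-of-empty (() ∷ _)

unique-subsets≤binomial : ∀ n k (L : List (Subset n)) → Unique L → HaveSize k L →
                          length L ≤ n C k
unique-subsets≤binomial zero    k       []                 _                 _ = z≤n
unique-subsets≤binomial zero    zero    ([] ∷ [])          _                 _ = ≤-refl
unique-subsets≤binomial zero    zero    ([] ∷ [] ∷ _)      ((≢[] ∷ _) ∷ _)   _ = ⊥-elim (≢[] refl)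
unique-subsets≤binomial zero    (suc k) ([] ∷ _)           _                 (() ∷ _)
unique-subsets≤binomial (suc n) zero    L unique sizes = begin
  length L                                     ≡⟨ length-split L ⟩
  length (containing L) + length (avoiding L)  ≡⟨ cong (_+ length (avoiding L)) (containing-empty sizes) ⟩
  length (avoiding L)                          ≤⟨ unique-subsets≤binomial n zero (avoiding L)
                                                    (avoiding-Unique unique) (avoiding-All id sizes) ⟩
  suc n C zero                                 ∎
  where open ≤-Reasoning
unique-subsets≤binomial (suc n) (suc k) L unique sizes = begin
  length L                                     ≡⟨ length-split L ⟩
  length (containing L) + length (avoiding L)  ≤⟨ +-mono-≤
    (unique-subsets≤binomial n k (containing L) (containing-Unique unique) (containing-All (cong pred) sizes))
    (unique-subsets≤binomial n (suc k) (avoiding L) (avoiding-Unique unique) (avoiding-All id sizes)) ⟩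
  n C k + n C suc k                            ≡⟨ nCk+nC[k+1]≡[n+1]C[k+1] n k ⟩
  suc n C suc k                                ∎
  where open ≤-Reasoning

k-subset : ∀ n k → k ≤ n → Σ (Subset n) (λ A → ∣ A ∣ ≡ k)
k-subset n       zero    _           = ⊥ , ∣⊥∣≡0 n
k-subset (suc n) (suc k) (s≤s k≤n) with k-subset n k k≤n
... | A , ∣A∣≡k = true ∷ A , cong suc ∣A∣≡k

image : {n : ℕ} → Permutation′ n → Subset n → Subset n
image σ A = tabulate (λ y → lookup A (σ ⟨$⟩ˡ y))

∈-image⇔ : {n : ℕ} (σ : Permutation′ n) (A : Subset n) (y : Fin n) →
           (y ∈ image σ A) ⇔ (σ ⟨$⟩ˡ y ∈ A)
∈-image⇔ σ A y = mk⇔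
  (λ y∈σA → lookup⇒[]= _ A (trans (sym (lookup∘tabulate _ y)) ([]=⇒lookup y∈σA)))
  (λ σ⁻¹y∈A → lookup⇒[]= y (image σ A) (trans (lookup∘tabulate _ y) ([]=⇒lookup σ⁻¹y∈A)))

∈Image⇔∈image : {n : ℕ} (σ : Permutation′ n) (A : Subset n) (y : Fin n) →
                (y ∈Image (σ , A)) ⇔ (y ∈ image σ A)
∈Image⇔∈image σ A y = mk⇔ to from
  where
  to : y ∈Image (σ , A) → y ∈ image σ A
  to (a , a∈A , σa≡y) = Equivalence.from (∈-image⇔ σ A y)
    (subst (_∈ A) (trans (sym (inverseˡ σ)) (cong (σ ⟨$⟩ˡ_) σa≡y)) a∈A)
  from : y ∈ image σ A → y ∈Image (σ , A)
  from y∈σA = σ ⟨$⟩ˡ y , Equivalence.to (∈-image⇔ σ A y) y∈σA , inverseʳ σ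

-- Counting a subset as a sum of 0/1 indicators, so that sums can be permuted.
indicator : Bool → ℕ
indicator true  = 1
indicator false = 0

∣∣≡sum : {n : ℕ} (A : Subset n) → ∣ A ∣ ≡ sum (indicator ∘ lookup A)
∣∣≡sum []          = refl
∣∣≡sum (true  ∷ A) = cong suc (∣∣≡sum A)
∣∣≡sum (false ∷ A) = ∣∣≡sum A

∣image∣ : {n : ℕ} (σ : Permutation′ n) (A : Subset n) → ∣ image σ A ∣ ≡ ∣ A ∣
∣image∣ σ A = begin
  ∣ image σ A ∣                           ≡⟨ ∣∣≡sum (image σ A) ⟩
  sum (indicator ∘ lookup (image σ A))    ≡⟨ sum-cong-≗ (cong indicator ∘ lookup∘tabulate (lookup A ∘ (σ ⟨$⟩ˡ_))) ⟩
  sum (indicator ∘ lookup A ∘ (σ ⟨$⟩ˡ_))  ≡⟨ sum-permute (indicator ∘ lookup A) (flip σ) ⟨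
  sum (indicator ∘ lookup A)              ≡⟨ ∣∣≡sum A ⟨
  ∣ A ∣                                   ∎
  where open ≡-Reasoning

image-∘ : {n : ℕ} {s u v : Permutation′ n} → (∀ x → s ⟨$⟩ʳ (u ⟨$⟩ʳ x) ≡ v ⟨$⟩ʳ x) →
          (A : Subset n) → image s (image u A) ≡ image v A
image-∘ {s = s} {u} {v} s∘u≡v A = tabulate-cong λ y → begin
  lookup (image u A) (s ⟨$⟩ˡ y)  ≡⟨ lookup∘tabulate _ (s ⟨$⟩ˡ y) ⟩
  lookup A (w y)                 ≡⟨ cong (lookup A) (inverse-∘ y) ⟨
  lookup A (v ⟨$⟩ˡ y)            ∎
  where
  open ≡-Reasoning
  w : Fin _ → Fin _
  w y = u ⟨$⟩ˡ (s ⟨$⟩ˡ y)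
  inverse-∘ : ∀ y → v ⟨$⟩ˡ y ≡ w y
  inverse-∘ y = begin
    v ⟨$⟩ˡ y                       ≡⟨ cong (v ⟨$⟩ˡ_) (trans (cong (s ⟨$⟩ʳ_) (inverseʳ u)) (inverseʳ s)) ⟨
    v ⟨$⟩ˡ (s ⟨$⟩ʳ (u ⟨$⟩ʳ w y))  ≡⟨ cong (v ⟨$⟩ˡ_) (s∘u≡v (w y)) ⟩
    v ⟨$⟩ˡ (v ⟨$⟩ʳ w y)            ≡⟨ inverseˡ v ⟩
    w y                            ∎

image-fixed⇒Fixes : {n : ℕ} (σ : Permutation′ n) (B : Subset n) → image σ B ≡ B → Fixes σ B
image-fixed⇒Fixes σ B σB≡B y = mk⇔
  (λ y∈σB → subst (y ∈_) σB≡B (Equivalence.to (∈Image⇔∈image σ B y) y∈σB))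
  (λ y∈B → Equivalence.from (∈Image⇔∈image σ B y) (subst (y ∈_) (sym σB≡B) y∈B))

-- If v = s ∘ u with s a k-derangement, then u(A) ≠ v(A) for every k-subset A:
-- otherwise s would fix the k-subset u(A).
adjacent⇒distinct-images : {n k : ℕ} (A : Subset n) → ∣ A ∣ ≡ k →
                           {u v : Permutation′ n} → Adjacent k u v → image u A ≢ image v A
adjacent⇒distinct-images A ∣A∣≡k {u} {v} (s , derangement , s∘u≡v) uA≡vA =
  derangement (image u A) (trans (∣image∣ u A) ∣A∣≡k)
    (image-fixed⇒Fixes s (image u A) (trans (image-∘ {s = s} {u} {v} s∘u≡v A) (sym uA≡vA)))

-- The clique bound.
lemma2 : (k n : ℕ) → 1 ≤ k → k < n → (Q : List (Permutation′ n)) →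
    IsClique k Q → length Q ≤ n C k
lemma2 k n _ k<n Q clique with k-subset n k (<⇒≤ k<n)
... | A , ∣A∣≡k = subst (_≤ n C k) (length-map imageOfA Q)
  (unique-subsets≤binomial n k (map imageOfA Q) images-distinct images-have-size-k)
  where
  imageOfA : Permutation′ n → Subset n
  imageOfA u = image u A

  images-distinct : Unique (map imageOfA Q)
  images-distinct = AllPairs.map⁺
    (AllPairs.map (λ {u} {v} (_ , adjacent) →
      adjacent⇒distinct-images A ∣A∣≡k {u} {v} adjacent) clique)

  images-have-size-k : HaveSize k (map imageOfA Q)
  images-have-size-k = All.map⁺ (universal (λ u → trans (∣image∣ u A) ∣A∣≡k) Q)
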